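{- Let $G$ be an $r$-regular graph, let $k\ge 0$ be an integer, let $S(G)$ be the $3k$-subdivision of $G$, let $e=vw\in E(G)$, and let $P$ be a perfect edge dominating set of $S(G)$. Then (1) $|S(e)\cap P|\ge k$; (2) if $|S(e)\cap P|=k$, then $e_0,e_{3k}\notin P$, exactly one of $v,w$ is white and exactly one of $v,w$ is yellow (colours taken with respect to $P$ in $S(G)$).
   Context: Graphs are finite, simple and undirected. An edge dominates itself and every edge sharing an endpoint with it. A set $P\subseteq E(H)$ is a perfect edge dominating set of $H$ if every edge of $E(H)\setminus P$ is dominated by exactly one edge of $P$. For a perfect edge dominating set $P$ of $H$, a vertex is black if it is incident to at least two edges of $P$, yellow if incident to exactly one edge of $P$, and white if incident to no edge of $P$. For an integer $m\ge 0$ and an edge $e=vw$, the $m$-subdivision of $e$ replaces $e$ by a path $S(e)$ with edges $e_0,e_1,\dots,e_m$ whose $m$ internal vertices are new vertices of degree 2, with $e_0$ incident to $v$ and $e_m$ incident to $w$; the $m$-subdivision $S(G)$ of $G$ is obtained by doing this for every edge of $G$. Here $m=3k$. -}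

module Defs where

open import Data.Nat using (ℕ; zero; suc; _≤_; _*_)
open import Data.Fin using (Fin; zero; suc; inject₁; fromℕ)
open import Data.Bool using (Bool; true; false; _∧_; _∨_)
open import Data.List using (List; filterᵇ; length; map; concatMap; allFin)
open import Data.List.Membership.Propositional using (_∈_)
open import Data.List.Relation.Unary.Unique.Propositional using (Unique)
open import Data.Maybe using (Maybe; just; nothing; maybe)
import Data.Maybe as Maybe
open import Data.Product using (_×_; _,_; proj₁; proj₂)
open import Data.Sum using (_⊎_; inj₁; inj₂)
import Data.Sum.Properties as SumP
import Data.Product.Properties as ProdP
import Data.Fin.Properties as FinP
open import Relation.Nullary using (¬_; does)
open import Relation.Binary.Definitions using (DecidableEquality)
open import Relation.Binary.PropositionalEquality using (_≡_; _≢_)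

SameEnds : {V : Set} → V × V → V × V → Set
SameEnds (a , b) (c , d) = (a ≡ c × b ≡ d) ⊎ (a ≡ d × b ≡ c)

record FinGraph : Set₁ where
  field
    V E            : Set
    _≟V_           : DecidableEquality V
    _≟E_           : DecidableEquality E
    vlist          : List V
    elist          : List E
    ends           : E → V × V

open FinGraph public

record IsSimpleGraph (H : FinGraph) : Set where
  field
    vlist-complete : ∀ v → v ∈ vlist H
    vlist-unique   : Unique (vlist H)
    elist-complete : ∀ e → e ∈ elist H
    elist-unique   : Unique (elist H)
    loopless       : ∀ e → proj₁ (ends H e) ≢ proj₂ (ends H e)
    simple         : ∀ e f → SameEnds (ends H e) (ends H f) → e ≡ f


count : {A : Set} → (A → Bool) → List A → ℕ
count p xs = length (filterᵇ p xs)

incident : (H : FinGraph) → V H → E H → Bool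
incident H v e = does ((_≟V_ H) v (proj₁ (ends H e))) ∨ does ((_≟V_ H) v (proj₂ (ends H e)))

degree : (H : FinGraph) → V H → ℕ
degree H v = count (incident H v) (elist H)

Regular : FinGraph → ℕ → Set
Regular H r = ∀ v → degree H v ≡ r

-- edge g dominates edge f: g = f or g shares an endpoint with f
-- (g = f is subsumed, since an edge shares its endpoints with itself)
dominates : (H : FinGraph) → E H → E H → Bool
dominates H g f = incident H (proj₁ (ends H f)) g ∨ incident H (proj₂ (ends H f)) g

PerfectEDS : (H : FinGraph) → (E H → Bool) → Set
PerfectEDS H P = ∀ f → P f ≡ false → count (λ g → P g ∧ dominates H g f) (elist H) ≡ 1

pdeg : (H : FinGraph) → (E H → Bool) → V H → ℕ
pdeg H P v = count (λ g → P g ∧ incident H v g) (elist H)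

Black Yellow White : (H : FinGraph) → (E H → Bool) → V H → Set
Black  H P v = 2 ≤ pdeg H P v
Yellow H P v = pdeg H P v ≡ 1
White  H P v = pdeg H P v ≡ 0

ExactlyOne : {A : Set} → (A → Set) → A → A → Set
ExactlyOne Q a b = (Q a × ¬ Q b) ⊎ (¬ Q a × Q b)

-- Vertices: old vertices, plus m new vertices (e , j)
-- on each edge e.  Edges: (e , j) for j = 0..m is the edge e_j of S(e).
-- With ends e = (v , w), the path S(e) is
--   v = node 0, node 1 = (e,0), ..., node m = (e,m-1), node (m+1) = w,
-- and e_j joins node j and node (j+1); so e_0 is incident to v, e_m to w.

inner : ∀ m → Fin (suc m) → Maybe (Fin m)
inner zero    zero    = nothing
inner (suc m) zero    = just zero
inner (suc m) (suc t) = Maybe.map suc (inner m t)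

module Subdiv (G : FinGraph) (m : ℕ) where
  SV : Set
  SV = V G ⊎ (E G × Fin m)

  SE : Set
  SE = E G × Fin (suc m)

  node : E G → Fin (suc (suc m)) → SV
  node e zero    = inj₁ (proj₁ (ends G e))
  node e (suc t) = maybe (λ j → inj₂ (e , j)) (inj₁ (proj₂ (ends G e))) (inner m t)

  sends : SE → SV × SV
  sends (e , j) = node e (inject₁ j) , node e (suc j)

  _≟SV_ : DecidableEquality SV
  _≟SV_ = SumP.≡-dec (_≟V_ G) (ProdP.≡-dec (_≟E_ G) FinP._≟_)

  svlist : List SV
  svlist = map inj₁ (vlist G) Data.List.++ concatMap (λ e → map (λ j → inj₂ (e , j)) (allFin m)) (elist G)
    where import Data.List

  selist : List SE
  selist = concatMap (λ e → map (λ j → (e , j)) (allFin (suc m))) (elist G)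

  S : FinGraph
  S = record { V = SV ; E = SE ; _≟V_ = _≟SV_
             ; _≟E_ = ProdP.≡-dec (_≟E_ G) FinP._≟_
             ; vlist = svlist ; elist = selist ; ends = sends }

Subdivision : FinGraph → ℕ → FinGraph
Subdivision G m = Subdiv.S G m

pathCount : (G : FinGraph) (m : ℕ) → E G → (E (Subdivision G m) → Bool) → ℕ
pathCount G m e P = count (λ j → P (e , j)) (allFin (suc m))

-- On S(e) every inner vertex has degree 2, so an inner edge e_j ∉ P is dominated by
-- exactly one of e_{j-1}, e_{j+1}.  Hence each block e_{3i}, e_{3i+1}, e_{3i+2} meets P,
-- which gives |S(e) ∩ P| ≥ k; in the tight case every block meets P exactly once and
-- e_{3i} ∉ P, so e_0, e_{3k} ∉ P and, the pattern having period 3, exactly one of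
-- e_1, e_{3k-1} is in P.  For an edge xy ∉ P that is the only edge joining x and y,
-- perfection says pdeg x + pdeg y = 1.  Applied to e_0 and e_{3k} (for k = 0 to the edge
-- vw itself, using simplicity of G) this gives pdeg v + pdeg w = 1: one end is white and
-- the other yellow.
module Submission where

open import Defs
open import Data.Nat using (ℕ; zero; suc; _+_; _*_; _≤_; _<_; z≤n; s≤s)
open import Data.Nat.Properties
open import Data.Bool using (Bool; true; false; _∧_; _∨_; not; _xor_)
open import Data.Bool.Properties using (∧-distribˡ-∨; ∧-zeroʳ; ∧-identityʳ)
open import Data.Fin using (Fin; zero; suc; toℕ; inject₁; fromℕ)
open import Data.Fin.Properties using (toℕ-inject₁)
open import Function using (_∘_)
open import Data.Maybe using (just; nothing)
open import Data.List using (List; []; _∷_; tabulate; map; allFin)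
open import Data.List.Membership.Propositional.Properties using (∈-map⁺; ∈-concatMap⁺; ∈-allFin)
import Data.List.Relation.Unary.Any as Any
open import Data.List.Membership.Propositional using (_∈_)
open import Data.List.Relation.Unary.Any using (here; there)
open import Data.Product using (∃; _×_; _,_; proj₁; proj₂)
open import Data.Sum using (_⊎_; inj₁; inj₂)
open import Data.Sum.Properties using (inj₁-injective)
open import Data.Empty using (⊥-elim)
open import Relation.Nullary using (yes; no)
open import Relation.Binary.PropositionalEquality

bit : Bool → ℕ
bit true  = 1
bit false = 0

sum≡1 : ∀ {x y} → x + y ≡ 1 → (x ≡ 0 × y ≡ 1) ⊎ (x ≡ 1 × y ≡ 0)
sum≡1 {0}     refl = inj₁ (refl , refl)
sum≡1 {1} {0} refl = inj₂ (refl , refl)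

sum≡1-complement : ∀ {x y} b → x + y ≡ 1 → (b ≡ true → y ≢ 0) → (b ≡ false → y ≡ 0) → x ≡ bit (not b)
sum≡1-complement true  sum y≢0 _   with sum≡1 sum
... | inj₁ (x≡0 , _)  = x≡0
... | inj₂ (_ , y≡0)  = ⊥-elim (y≢0 refl y≡0)
sum≡1-complement false sum _   y≡0 with sum≡1 sum
... | inj₁ (_ , y≡1)  = ⊥-elim (0≢1+n (trans (sym (y≡0 refl)) y≡1))
... | inj₂ (x≡1 , _)  = x≡1

tight-split : ∀ {a b k} → 1 ≤ a → k ≤ b → a + b ≡ suc k → a ≡ 1 × b ≡ k
tight-split {suc a} {b} {k} _ k≤b a+b≡k = cong suc (+-cancelʳ-≡ b a 0 (trans a+b≡k' (sym b≡k))) , b≡k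
  where
  a+b≡k' : a + b ≡ k
  a+b≡k' = suc-injective a+b≡k
  b≡k : b ≡ k
  b≡k = ≤-antisym (m+n≤o⇒n≤o a (≤-reflexive a+b≡k')) k≤b

xor-trans : ∀ {a b c} → a xor b ≡ true → b xor c ≡ true → a ≡ c
xor-trans {true}  {false} {true}  _ _ = refl
xor-trans {false} {true}  {false} _ _ = refl
xor-trans {true}  {true}  () _
xor-trans {false} {false} () _
xor-trans {true}  {false} {false} _ ()
xor-trans {false} {true}  {true}  _ ()

bit-not+bit-not : ∀ {a b} → a xor b ≡ true → bit (not a) + bit (not b) ≡ 1
bit-not+bit-not {true}  {false} _ = refl
bit-not+bit-not {false} {true}  _ = refl

module _ {A : Set} where

  count-∷ : (p : A → Bool) (x : A) (xs : List A) → count p (x ∷ xs) ≡ bit (p x) + count p xs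
  count-∷ p x xs with p x
  ... | true  = refl
  ... | false = refl

  count-cong : {p q : A → Bool} → (∀ x → p x ≡ q x) → ∀ xs → count p xs ≡ count q xs
  count-cong         p≗q []       = refl
  count-cong {p} {q} p≗q (x ∷ xs) = begin
    count p (x ∷ xs)        ≡⟨ count-∷ p x xs ⟩
    bit (p x) + count p xs  ≡⟨ cong₂ _+_ (cong bit (p≗q x)) (count-cong p≗q xs) ⟩
    bit (q x) + count q xs  ≡⟨ count-∷ q x xs ⟨
    count q (x ∷ xs)        ∎
    where open ≡-Reasoning

  count-none : {p : A → Bool} → (∀ x → p x ≡ false) → ∀ xs → count p xs ≡ 0
  count-none         p≡false []       = refl
  count-none {p = p} p≡false (x ∷ xs) rewrite count-∷ p x xs | p≡false x = count-none p≡false xs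

  count-∈ : (p : A → Bool) {x : A} {xs : List A} → x ∈ xs → p x ≡ true → count p xs ≢ 0
  count-∈ p {xs = x ∷ xs} (here refl) px≡true rewrite count-∷ p x xs | px≡true = λ ()
  count-∈ p {xs = y ∷ xs} (there x∈xs) px≡true rewrite count-∷ p y xs =
    λ eq → count-∈ p x∈xs px≡true (m+n≡0⇒n≡0 (bit (p y)) eq)

  count-∨+count-∧ : (p q : A → Bool) (xs : List A) →
    count (λ x → p x ∨ q x) xs + count (λ x → p x ∧ q x) xs ≡ count p xs + count q xs
  count-∨+count-∧ p q [] = refl
  count-∨+count-∧ p q (x ∷ xs)
    rewrite count-∷ (λ x → p x ∨ q x) x xs | count-∷ (λ x → p x ∧ q x) x xs
          | count-∷ p x xs | count-∷ q x xs
    = step (p x) (q x) (count-∨+count-∧ p q xs)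
    where
    step : ∀ a b {c d e f} → c + d ≡ e + f →
           (bit (a ∨ b) + c) + (bit (a ∧ b) + d) ≡ (bit a + e) + (bit b + f)
    step true  true  {c} {d} {e} {f} eq = cong suc (trans (+-suc c d) (trans (cong suc eq) (sym (+-suc e f))))
    step true  false eq = cong suc eq
    step false true  {e = e} {f} eq = trans (cong suc eq) (sym (+-suc e f))
    step false false eq = eq

module _ (H : FinGraph) where

  incident⇒≡ : ∀ {u g} → incident H u g ≡ true → u ≡ proj₁ (ends H g) ⊎ u ≡ proj₂ (ends H g)
  incident⇒≡ {u} {g} inc with (_≟V_ H) u (proj₁ (ends H g)) | (_≟V_ H) u (proj₂ (ends H g))
  ... | yes u≡x | _      = inj₁ u≡x
  ... | no _    | yes u≡y = inj₂ u≡y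
  ... | no _    | no _    with () ← inc

  incident-proj₁ : ∀ g → incident H (proj₁ (ends H g)) g ≡ true
  incident-proj₁ g with (_≟V_ H) (proj₁ (ends H g)) (proj₁ (ends H g))
  ... | yes _ = refl
  ... | no x≢x = ⊥-elim (x≢x refl)

  incident-proj₂ : ∀ g → incident H (proj₂ (ends H g)) g ≡ true
  incident-proj₂ g with (_≟V_ H) (proj₂ (ends H g)) (proj₁ (ends H g)) | (_≟V_ H) (proj₂ (ends H g)) (proj₂ (ends H g))
  ... | yes _ | _     = refl
  ... | no _  | yes _ = refl
  ... | no _  | no y≢y = ⊥-elim (y≢y refl)

  incident-ends : ∀ {g x y} → ends H g ≡ (x , y) → incident H x g ≡ true × incident H y g ≡ true
  incident-ends {g} ends≡ = subst (λ (u , _) → incident H u g ≡ true) ends≡ (incident-proj₁ g)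
                          , subst (λ (_ , v) → incident H v g ≡ true) ends≡ (incident-proj₂ g)

  -- Every P-edge dominating f ∉ P is counted once in pdeg x + pdeg y, unless it meets both ends.
  pdeg-ends : ∀ P → PerfectEDS H P → ∀ {f x y} → ends H f ≡ (x , y) → P f ≡ false →
              (∀ g → P g ≡ true → incident H x g ≡ true → incident H y g ≡ false) →
              pdeg H P x + pdeg H P y ≡ 1
  pdeg-ends P perfect {f} {x} {y} ends≡ f∉P disjoint = begin
    pdeg H P x + pdeg H P y
      ≡⟨ count-∨+count-∧ atX atY (elist H) ⟨
    count (λ g → atX g ∨ atY g) (elist H) + count (λ g → atX g ∧ atY g) (elist H)
      ≡⟨ cong₂ _+_ (count-cong dominating (elist H)) (count-none atBoth (elist H)) ⟩
    count (λ g → P g ∧ dominates H g f) (elist H) + 0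
      ≡⟨ +-identityʳ _ ⟩
    count (λ g → P g ∧ dominates H g f) (elist H)
      ≡⟨ perfect f f∉P ⟩
    1 ∎
    where
    open ≡-Reasoning
    atX atY : E H → Bool
    atX g = P g ∧ incident H x g
    atY g = P g ∧ incident H y g
    dominating : ∀ g → (atX g ∨ atY g) ≡ (P g ∧ dominates H g f)
    dominating g = begin
      atX g ∨ atY g                               ≡⟨ ∧-distribˡ-∨ (P g) _ _ ⟨
      P g ∧ (incident H x g ∨ incident H y g)     ≡⟨ cong (λ (u , v) → P g ∧ (incident H u g ∨ incident H v g)) ends≡ ⟨
      P g ∧ dominates H g f                       ∎
    atBoth : ∀ g → (atX g ∧ atY g) ≡ false
    atBoth g with P g in g∈P | incident H x g in x∈g
    ... | false | _     = refl
    ... | true  | false = refl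
    ... | true  | true  rewrite disjoint g g∈P x∈g = refl

  module _ (loopless : ∀ g → proj₁ (ends H g) ≢ proj₂ (ends H g))
           (simple : ∀ g h → SameEnds (ends H g) (ends H h) → g ≡ h) where

    joins-ends⇒≡ : ∀ {f g} → incident H (proj₁ (ends H f)) g ≡ true → incident H (proj₂ (ends H f)) g ≡ true → g ≡ f
    joins-ends⇒≡ {f} {g} inc₁ inc₂ with incident⇒≡ inc₁ | incident⇒≡ inc₂
    ... | inj₁ x≡a | inj₁ y≡a = ⊥-elim (loopless f (trans x≡a (sym y≡a)))
    ... | inj₁ x≡a | inj₂ y≡b = simple g f (inj₁ (sym x≡a , sym y≡b))
    ... | inj₂ x≡b | inj₁ y≡a = simple g f (inj₂ (sym y≡a , sym x≡b))
    ... | inj₂ x≡b | inj₂ y≡b = ⊥-elim (loopless f (trans x≡b (sym y≡b)))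

    pdeg-ends-simple : ∀ P → PerfectEDS H P → ∀ {f} → P f ≡ false →
                       pdeg H P (proj₁ (ends H f)) + pdeg H P (proj₂ (ends H f)) ≡ 1
    pdeg-ends-simple P perfect {f} f∉P = pdeg-ends P perfect refl f∉P misses
      where
      misses : ∀ g → P g ≡ true → incident H (proj₁ (ends H f)) g ≡ true → incident H (proj₂ (ends H f)) g ≡ false
      misses g g∈P inc₁ with incident H (proj₂ (ends H f)) g in inc₂
      ... | false = refl
      ... | true with refl ← joins-ends⇒≡ inc₁ inc₂ with () ← trans (sym g∈P) f∉P

exactlyOne-white-yellow : ∀ H P x y → pdeg H P x + pdeg H P y ≡ 1 →
  ExactlyOne (White H P) x y × ExactlyOne (Yellow H P) x y
exactlyOne-white-yellow H P x y sum with sum≡1 sum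
... | inj₁ (x≡0 , y≡1) = inj₁ (x≡0 , λ y≡0 → 0≢1+n (trans (sym y≡0) y≡1))
                       , inj₂ ((λ x≡1 → 0≢1+n (trans (sym x≡0) x≡1)) , y≡1)
... | inj₂ (x≡1 , y≡0) = inj₂ ((λ x≡0 → 0≢1+n (trans (sym x≡0) x≡1)) , y≡0)
                       , inj₁ (x≡1 , λ y≡1 → 0≢1+n (trans (sym y≡0) y≡1))

countUpTo : (ℕ → Bool) → ℕ → ℕ
countUpTo X zero    = 0
countUpTo X (suc n) = bit (X 0) + countUpTo (λ i → X (suc i)) n

-- X j says whether e_j ∈ P, on a path e_0 … e_m whose inner vertices have degree 2.
PerfectPath : (ℕ → Bool) → ℕ → Set
PerfectPath X m = ∀ j → 2 + j ≤ m → X (suc j) ≡ false → X j xor X (2 + j) ≡ true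

block : (ℕ → Bool) → ℕ
block X = bit (X 0) + (bit (X 1) + bit (X 2))

countUpTo-drop3 : ∀ X m → countUpTo X (4 + m) ≡ block X + countUpTo (λ i → X (3 + i)) (suc m)
countUpTo-drop3 X m = begin
  bit (X 0) + (bit (X 1) + (bit (X 2) + rest))  ≡⟨ cong (bit (X 0) +_) (+-assoc (bit (X 1)) _ _) ⟨
  bit (X 0) + ((bit (X 1) + bit (X 2)) + rest)  ≡⟨ +-assoc (bit (X 0)) _ _ ⟨
  block X + rest                                ∎
  where
  open ≡-Reasoning
  rest = countUpTo (λ i → X (3 + i)) (suc m)

module _ (X : ℕ → Bool) {m : ℕ} (perfect : PerfectPath X (3 + m)) where

  perfectPath-drop3 : PerfectPath (λ i → X (3 + i)) m
  perfectPath-drop3 j 2+j≤m = perfect (3 + j) (s≤s (s≤s (s≤s 2+j≤m)))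

  -- If e_1 ∉ P, one of its neighbours dominates it.
  block-pos : 1 ≤ block X
  block-pos with X 0 | X 1 | X 2 | perfect 0 (s≤s (s≤s z≤n))
  ... | true  | _     | _     | _ = s≤s z≤n
  ... | false | true  | _     | _ = s≤s z≤n
  ... | false | false | true  | _ = s≤s z≤n
  ... | false | false | false | e₁-dominated with () ← e₁-dominated refl

  -- If e_0 ∈ P the block forces e_1, e_2 ∉ P, and then only e_3 could dominate e_2.
  block-start : block X ≡ 1 → X 3 ≡ false → X 0 ≡ false
  block-start block≡1 X3≡false
    with X 0 | X 1 | X 2 | perfect 1 (s≤s (s≤s (s≤s z≤n)))
  ... | false | _     | _     | _ = refl
  ... | true  | false | false | e₂-dominated with () ← subst (λ b → false xor b ≡ true) X3≡false (e₂-dominated refl)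
  ... | true  | true  | _     | _ with () ← block≡1
  ... | true  | false | true  | _ with () ← block≡1

  block-end : block X ≡ 1 → X 0 ≡ false → X 1 xor X 2 ≡ true
  block-end block≡1 X0≡false with X 0 | X 1 | X 2
  block-end ()     refl | false | false | false
  block-end refl   refl | false | false | true  = refl
  block-end refl   refl | false | true  | false = refl
  block-end ()     refl | false | true  | true

perfectPath-count : ∀ k X → PerfectPath X (k * 3) → k ≤ countUpTo X (suc (k * 3))
perfectPath-count zero    X perfect = z≤n
perfectPath-count (suc k) X perfect = begin
  suc k                                 ≤⟨ +-mono-≤ (block-pos X perfect) (perfectPath-count k Y (perfectPath-drop3 X perfect)) ⟩
  block X + countUpTo Y (suc (k * 3))   ≡⟨ countUpTo-drop3 X (k * 3) ⟨
  countUpTo X (suc (suc k * 3))         ∎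
  where
  open ≤-Reasoning
  Y : ℕ → Bool
  Y i = X (3 + i)

perfectPath-tight-split : ∀ k X (perfect : PerfectPath X (suc k * 3)) →
  countUpTo X (suc (suc k * 3)) ≡ suc k →
  block X ≡ 1 × countUpTo (λ i → X (3 + i)) (suc (k * 3)) ≡ k
perfectPath-tight-split k X perfect tight =
  tight-split (block-pos X perfect) (perfectPath-count k (λ i → X (3 + i)) (perfectPath-drop3 X perfect))
              (trans (sym (countUpTo-drop3 X (k * 3))) tight)

perfectPath-tight : ∀ k X → PerfectPath X (k * 3) → countUpTo X (suc (k * 3)) ≡ k →
                    X 0 ≡ false × X (k * 3) ≡ false
perfectPath-tight zero    X perfect tight with X 0
... | false = refl , refl
perfectPath-tight (suc k) X perfect tight =
  block-start X perfect (proj₁ split) (proj₁ rest) , proj₂ rest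
  where
  split : block X ≡ 1 × countUpTo (λ i → X (3 + i)) (suc (k * 3)) ≡ k
  split = perfectPath-tight-split k X perfect tight
  rest : X 3 ≡ false × X (suc k * 3) ≡ false
  rest = perfectPath-tight k (λ i → X (3 + i)) (perfectPath-drop3 X perfect) (proj₂ split)

-- In the tight case the pattern of P along the path has period 3 with e_{3i} ∉ P,
-- so e_1 and e_{3k-1} lie on opposite sides.
perfectPath-tight-xor : ∀ k X → PerfectPath X (suc k * 3) → countUpTo X (suc (suc k * 3)) ≡ suc k →
                        X 1 xor X (2 + k * 3) ≡ true
perfectPath-tight-xor zero X perfect tight =
  block-end X perfect (proj₁ (perfectPath-tight-split 0 X perfect tight))
                      (proj₁ (perfectPath-tight 1 X perfect tight))
perfectPath-tight-xor (suc k) X perfect tight =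
  subst (λ b → b xor X (5 + k * 3) ≡ true) (sym X1≡X4)
        (perfectPath-tight-xor k (λ i → X (3 + i)) (perfectPath-drop3 X perfect) (proj₂ split))
  where
  split : block X ≡ 1 × countUpTo (λ i → X (3 + i)) (suc (suc k * 3)) ≡ suc k
  split = perfectPath-tight-split (suc k) X perfect tight
  X0≡false : X 0 ≡ false
  X0≡false = proj₁ (perfectPath-tight (suc (suc k)) X perfect tight)
  X3≡false : X 3 ≡ false
  X3≡false = proj₁ (perfectPath-tight (suc k) (λ i → X (3 + i)) (perfectPath-drop3 X perfect) (proj₂ split))
  X1≡X4 : X 1 ≡ X 4
  X1≡X4 = xor-trans (block-end X perfect (proj₁ split) X0≡false)
                    (perfect 2 (s≤s (s≤s (s≤s (s≤s z≤n)))) X3≡false)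

clamp : ∀ m → ℕ → Fin (suc m)
clamp m       zero    = zero
clamp zero    (suc n) = zero
clamp (suc m) (suc n) = suc (clamp m n)

clamp-toℕ : ∀ m (i : Fin (suc m)) → clamp m (toℕ i) ≡ i
clamp-toℕ m       zero    = refl
clamp-toℕ (suc m) (suc i) = cong suc (clamp-toℕ m i)

toℕ-clamp : ∀ {m n} → n ≤ m → toℕ (clamp m n) ≡ n
toℕ-clamp {m}     {zero}  _         = refl
toℕ-clamp {suc m} {suc n} (s≤s n≤m) = cong suc (toℕ-clamp n≤m)

inject₁-clamp : ∀ {m n} → n ≤ m → inject₁ (clamp m n) ≡ clamp (suc m) n
inject₁-clamp {m}     {zero}  _         = refl
inject₁-clamp {suc m} {suc n} (s≤s n≤m) = cong suc (inject₁-clamp n≤m)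

clamp-fromℕ : ∀ m → clamp m m ≡ fromℕ m
clamp-fromℕ zero    = refl
clamp-fromℕ (suc m) = cong suc (clamp-fromℕ m)

count-tabulate : ∀ {A : Set} m (p : A → Bool) (f : Fin (suc m) → A) →
                 count p (tabulate f) ≡ countUpTo (λ n → p (f (clamp m n))) (suc m)
count-tabulate zero    p f = count-∷ p (f zero) []
count-tabulate (suc m) p f =
  trans (count-∷ p (f zero) _) (cong (bit (p (f zero)) +_) (count-tabulate m p (λ i → f (suc i))))

inner-toℕ : ∀ {m t s} → inner m t ≡ just s → toℕ s ≡ toℕ t
inner-toℕ {suc m} {zero}  refl = refl
inner-toℕ {suc m} {suc t} eq with inner m t in eq′
inner-toℕ {suc m} {suc t} refl | just s = cong suc (inner-toℕ eq′)

inner-clamp : ∀ {m a} → a < m → ∃ λ s → inner m (clamp m a) ≡ just s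
inner-clamp {suc m} {zero}  _         = zero , refl
inner-clamp {suc m} {suc a} (s≤s a<m) with inner-clamp a<m
... | s , eq rewrite eq = suc s , refl

inner-last : ∀ m → inner m (clamp m m) ≡ nothing
inner-last zero    = refl
inner-last (suc m) rewrite inner-last m = refl

-- Positions on S(e) are indexed by ℕ: node n for n ≤ m + 1 (node 0 = v, node (m + 1) = w)
-- and edge e_n for n ≤ m; larger indices are clamped to the last position.
module SubdivisionPath (G : FinGraph) (m : ℕ) where
  open Subdiv G m

  pathNode : E G → ℕ → SV
  pathNode e n = node e (clamp (suc m) n)

  pathEdge : E G → ℕ → SE
  pathEdge e n = e , clamp m n

  ends-pathEdge : ∀ e {n} → n ≤ m → sends (pathEdge e n) ≡ (pathNode e n , pathNode e (suc n))
  ends-pathEdge e n≤m = cong (λ i → node e i , pathNode e (suc _)) (inject₁-clamp n≤m)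

  pathEdge-toℕ : ∀ (g : SE) → g ≡ pathEdge (proj₁ g) (toℕ (proj₂ g))
  pathEdge-toℕ (e , i) = cong (e ,_) (sym (clamp-toℕ m i))

  pathEdge-injective : ∀ e {a b} → a ≤ m → b ≤ m → pathEdge e a ≡ pathEdge e b → a ≡ b
  pathEdge-injective e a≤m b≤m eq =
    trans (sym (toℕ-clamp a≤m)) (trans (cong (toℕ ∘ proj₂) eq) (toℕ-clamp b≤m))

  pathNode-last : ∀ e → pathNode e (suc m) ≡ inj₁ (proj₂ (ends G e))
  pathNode-last e rewrite inner-last m = refl

  pathNode-inner : ∀ e {a} → a < m → ∃ λ s → pathNode e (suc a) ≡ inj₂ (e , s) × toℕ s ≡ a
  pathNode-inner e a<m with inner-clamp a<m
  ... | s , eq rewrite eq = s , refl , trans (inner-toℕ eq) (toℕ-clamp (<⇒≤ a<m))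

  node≡inner : ∀ {f t e s} → node f t ≡ inj₂ (e , s) → f ≡ e × toℕ t ≡ suc (toℕ s)
  node≡inner {f} {suc t} eq with inner m t in eq′
  node≡inner {f} {suc t} refl | just s = refl , cong suc (sym (inner-toℕ eq′))

  inner≢original : ∀ e {a x} → a < m → pathNode e (suc a) ≢ inj₁ x
  inner≢original e a<m eq with pathNode-inner e a<m
  ... | s , eq′ , _ with () ← trans (sym eq′) eq

  incident-inner : ∀ e {a} g → a < m → incident S (pathNode e (suc a)) g ≡ true →
                   g ≡ pathEdge e a ⊎ g ≡ pathEdge e (suc a)
  incident-inner e (f , i) a<m inc with pathNode-inner e a<m
  ... | s , inner≡ , toℕs≡a with incident⇒≡ S inc
  ... | inj₁ at₁ with node≡inner {f} {inject₁ i} (trans (sym at₁) inner≡)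
  ...   | refl , i≡ = inj₂ (trans (pathEdge-toℕ (f , i))
                              (cong (pathEdge f) (trans (sym (toℕ-inject₁ i)) (trans i≡ (cong suc toℕs≡a)))))
  incident-inner e (f , i) a<m inc | s , inner≡ , toℕs≡a | inj₂ at₂ with node≡inner {f} {suc i} (trans (sym at₂) inner≡)
  ...   | refl , i≡ = inj₁ (trans (pathEdge-toℕ (f , i)) (cong (pathEdge f) (trans (suc-injective i≡) toℕs≡a)))

  inner-edge-avoids-original : ∀ e {a x} → 2 + a ≤ m → incident S (inj₁ x) (pathEdge e (suc a)) ≡ false
  inner-edge-avoids-original e {a} {x} 2+a≤m with incident S (inj₁ x) (pathEdge e (suc a)) in inc
  ... | false = refl
  ... | true with incident⇒≡ S inc
  ...   | inj₁ at₁ = ⊥-elim (inner≢original e (<⇒≤ 2+a≤m) (sym (trans at₁ (cong proj₁ (ends-pathEdge e (<⇒≤ 2+a≤m))))))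
  ...   | inj₂ at₂ = ⊥-elim (inner≢original e 2+a≤m (sym (trans at₂ (cong proj₂ (ends-pathEdge e (<⇒≤ 2+a≤m))))))

  selist-complete : (∀ e → e ∈ elist G) → ∀ g → g ∈ selist
  selist-complete complete (f , i) =
    ∈-concatMap⁺ (λ e → map (e ,_) (allFin (suc m)))
                 (Any.map (λ { refl → ∈-map⁺ (f ,_) (∈-allFin i) }) (complete f))

  module _ (complete : ∀ e → e ∈ elist G) (P : SE → Bool) (perfect : PerfectEDS S P) (e : E G) where

    inP : ℕ → Bool
    inP n = P (pathEdge e n)

    pdeg-inner-zero : ∀ {a} → a < m → inP a ≡ false → inP (suc a) ≡ false →
                      pdeg S P (pathNode e (suc a)) ≡ 0
    pdeg-inner-zero {a} a<m a∉P sa∉P = count-none absent selist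
      where
      absent : ∀ g → (P g ∧ incident S (pathNode e (suc a)) g) ≡ false
      absent g with incident S (pathNode e (suc a)) g in inc
      ... | false = ∧-zeroʳ (P g)
      ... | true with incident-inner e g a<m inc
      ...   | inj₁ refl = trans (∧-identityʳ _) a∉P
      ...   | inj₂ refl = trans (∧-identityʳ _) sa∉P

    pdeg-inner-pos : ∀ {a} → a < m → inP a ≡ true ⊎ inP (suc a) ≡ true →
                     pdeg S P (pathNode e (suc a)) ≢ 0
    pdeg-inner-pos {a} a<m (inj₁ a∈P) =
      count-∈ _ (selist-complete complete (pathEdge e a))
              (cong₂ _∧_ a∈P (proj₂ (incident-ends S (ends-pathEdge e (<⇒≤ a<m)))))
    pdeg-inner-pos {a} a<m (inj₂ sa∈P) =
      count-∈ _ (selist-complete complete (pathEdge e (suc a)))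
              (cong₂ _∧_ sa∈P (proj₁ (incident-ends S (ends-pathEdge e a<m))))

    -- Internal vertices have degree 2, so a P-edge at node a + 1 is e_a or e_{a+1}.
    P-at-inner-after : ∀ {a g} → a < m → inP a ≡ false → P g ≡ true →
                       incident S (pathNode e (suc a)) g ≡ true → g ≡ pathEdge e (suc a)
    P-at-inner-after {g = g} a<m a∉P g∈P inc with incident-inner e g a<m inc
    ... | inj₁ refl with () ← trans (sym g∈P) a∉P
    ... | inj₂ g≡ = g≡

    P-at-inner-before : ∀ {a g} → a < m → inP (suc a) ≡ false → P g ≡ true →
                        incident S (pathNode e (suc a)) g ≡ true → g ≡ pathEdge e a
    P-at-inner-before {g = g} a<m sa∉P g∈P inc with incident-inner e g a<m inc
    ... | inj₁ g≡ = g≡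
    ... | inj₂ refl with () ← trans (sym g∈P) sa∉P

    pdeg-inner-pair : ∀ {j} → 2 + j ≤ m → inP (suc j) ≡ false →
                      pdeg S P (pathNode e (suc j)) + pdeg S P (pathNode e (2 + j)) ≡ 1
    pdeg-inner-pair {j} 2+j≤m sj∉P = pdeg-ends S P perfect (ends-pathEdge e (<⇒≤ 2+j≤m)) sj∉P misses
      where
      misses : ∀ g → P g ≡ true → incident S (pathNode e (suc j)) g ≡ true →
               incident S (pathNode e (2 + j)) g ≡ false
      misses g g∈P inc₁ with incident S (pathNode e (2 + j)) g in inc₂
      ... | false = refl
      ... | true  = ⊥-elim (1+n≰n (≤-trans (n≤1+n _) (≤-reflexive (pathEdge-injective e 2+j≤m j≤m e₂₊ⱼ≡eⱼ))))
        where
        j≤m : j ≤ m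
        j≤m = ≤-trans (n≤1+n _) (<⇒≤ 2+j≤m)
        e₂₊ⱼ≡eⱼ : pathEdge e (2 + j) ≡ pathEdge e j
        e₂₊ⱼ≡eⱼ = trans (sym (P-at-inner-after 2+j≤m sj∉P g∈P inc₂)) (P-at-inner-before (<⇒≤ 2+j≤m) sj∉P g∈P inc₁)

    inP-perfectPath : PerfectPath inP m
    inP-perfectPath j 2+j≤m sj∉P
      with inP j in j∈P | inP (2 + j) in 2+j∈P | sum≡1 (pdeg-inner-pair 2+j≤m sj∉P)
    ... | true  | false | _ = refl
    ... | false | true  | _ = refl
    ... | true  | true  | inj₁ (before≡0 , _) = ⊥-elim (pdeg-inner-pos (<⇒≤ 2+j≤m) (inj₁ j∈P) before≡0)
    ... | true  | true  | inj₂ (_ , after≡0) = ⊥-elim (pdeg-inner-pos 2+j≤m (inj₂ 2+j∈P) after≡0)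
    ... | false | false | inj₁ (_ , after≡1) =
      ⊥-elim (0≢1+n (trans (sym (pdeg-inner-zero 2+j≤m sj∉P 2+j∈P)) after≡1))
    ... | false | false | inj₂ (before≡1 , _) =
      ⊥-elim (0≢1+n (trans (sym (pdeg-inner-zero (<⇒≤ 2+j≤m) j∈P sj∉P)) before≡1))

    pdeg-start : 2 ≤ m → inP 0 ≡ false → pdeg S P (inj₁ (proj₁ (ends G e))) ≡ bit (not (inP 1))
    pdeg-start 2≤m 0∉P =
      sum≡1-complement (inP 1) (pdeg-ends S P perfect (ends-pathEdge e z≤n) 0∉P misses)
        (λ 1∈P → pdeg-inner-pos 0<m (inj₂ 1∈P)) (pdeg-inner-zero 0<m 0∉P)
      where
      0<m : 0 < m
      0<m = ≤-trans (s≤s z≤n) 2≤m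
      misses : ∀ g → P g ≡ true → incident S (inj₁ (proj₁ (ends G e))) g ≡ true →
               incident S (pathNode e 1) g ≡ false
      misses g g∈P inc₁ with incident S (pathNode e 1) g in inc₂
      ... | false = refl
      ... | true with refl ← P-at-inner-after 0<m 0∉P g∈P inc₂
                 with () ← trans (sym inc₁) (inner-edge-avoids-original e 2≤m)

    pdeg-end : ∀ {n} → 2 + n ≡ m → inP (2 + n) ≡ false →
               pdeg S P (inj₁ (proj₂ (ends G e))) ≡ bit (not (inP (suc n)))
    pdeg-end {n} 2+n≡m m∉P =
      sum≡1-complement (inP (suc n))
        (trans (+-comm _ (pdeg S P (pathNode e (2 + n)))) (pdeg-ends S P perfect ends≡ m∉P misses))
        (λ n+1∈P → pdeg-inner-pos 1+n<m (inj₁ n+1∈P)) (λ n+1∉P → pdeg-inner-zero 1+n<m n+1∉P m∉P)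
      where
      1+n<m : suc n < m
      1+n<m = ≤-reflexive 2+n≡m
      ends≡ : sends (pathEdge e (2 + n)) ≡ (pathNode e (2 + n) , inj₁ (proj₂ (ends G e)))
      ends≡ = trans (ends-pathEdge e 1+n<m) (cong (pathNode e (2 + n) ,_) (trans (cong (pathNode e ∘ suc) 2+n≡m) (pathNode-last e)))
      misses : ∀ g → P g ≡ true → incident S (pathNode e (2 + n)) g ≡ true →
               incident S (inj₁ (proj₂ (ends G e))) g ≡ false
      misses g g∈P inc₁ with refl ← P-at-inner-before 1+n<m m∉P g∈P inc₁ = inner-edge-avoids-original e 1+n<m

module Subdivision₀ (G : FinGraph) (simpleG : IsSimpleGraph G) where
  open Subdiv G 0
  open IsSimpleGraph simpleG

  loopless₀ : ∀ g → proj₁ (sends g) ≢ proj₂ (sends g)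
  loopless₀ (e , zero) eq = loopless e (inj₁-injective eq)

  simple₀ : ∀ g h → SameEnds (sends g) (sends h) → g ≡ h
  simple₀ (e , zero) (f , zero) (inj₁ (x≡ , y≡)) = cong (_, zero) (simple e f (inj₁ (inj₁-injective x≡ , inj₁-injective y≡)))
  simple₀ (e , zero) (f , zero) (inj₂ (x≡ , y≡)) = cong (_, zero) (simple e f (inj₂ (inj₁-injective x≡ , inj₁-injective y≡)))

module _ (G : FinGraph) (simpleG : IsSimpleGraph G) where
  open IsSimpleGraph simpleG using (elist-complete)

  inP : ∀ k (P : E (Subdivision G (3 * k)) → Bool) → PerfectEDS (Subdivision G (3 * k)) P → E G → ℕ → Bool
  inP k = SubdivisionPath.inP G (3 * k) elist-complete

  inP-perfectPath : ∀ k P perfect e → PerfectPath (inP k P perfect e) (k * 3)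
  inP-perfectPath k P perfect e =
    subst (PerfectPath (inP k P perfect e)) (*-comm 3 k)
          (SubdivisionPath.inP-perfectPath G (3 * k) elist-complete P perfect e)

  pathCount≡countUpTo : ∀ k P perfect e → pathCount G (3 * k) e P ≡ countUpTo (inP k P perfect e) (suc (k * 3))
  pathCount≡countUpTo k P perfect e =
    trans (count-tabulate (3 * k) (λ i → P (e , i)) (λ i → i))
          (cong (λ n → countUpTo (inP k P perfect e) (suc n)) (*-comm 3 k))

  inP-last : ∀ k P perfect e → inP k P perfect e (k * 3) ≡ P (e , fromℕ (3 * k))
  inP-last k P perfect e =
    trans (cong (λ n → P (e , clamp (3 * k) n)) (*-comm k 3)) (cong (λ i → P (e , i)) (clamp-fromℕ (3 * k)))

  pdeg-ends-tight : ∀ k P perfect e → countUpTo (inP k P perfect e) (suc (k * 3)) ≡ k →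
    pdeg (Subdivision G (3 * k)) P (inj₁ (proj₁ (ends G e))) + pdeg (Subdivision G (3 * k)) P (inj₁ (proj₂ (ends G e))) ≡ 1
  pdeg-ends-tight zero P perfect e tight =
    pdeg-ends-simple (Subdivision G 0) loopless₀ simple₀ P perfect {e , zero}
      (proj₁ (perfectPath-tight 0 (inP 0 P perfect e) (inP-perfectPath 0 P perfect e) tight))
    where open Subdivision₀ G simpleG
  pdeg-ends-tight (suc k) P perfect e tight = begin
    pdeg S P (inj₁ (proj₁ (ends G e))) + pdeg S P (inj₁ (proj₂ (ends G e)))
      ≡⟨ cong₂ _+_ (pdeg-start elist-complete P perfect e 2≤m (proj₁ ends∉P))
                   (pdeg-end elist-complete P perfect e (*-comm (suc k) 3) (proj₂ ends∉P)) ⟩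
    bit (not (X 1)) + bit (not (X (2 + k * 3)))
      ≡⟨ bit-not+bit-not {X 1} (perfectPath-tight-xor k X (inP-perfectPath (suc k) P perfect e) tight) ⟩
    1 ∎
    where
    open ≡-Reasoning
    open SubdivisionPath G (3 * suc k) using (pdeg-start; pdeg-end)
    S : FinGraph
    S = Subdivision G (3 * suc k)
    X : ℕ → Bool
    X = inP (suc k) P perfect e
    ends∉P : X 0 ≡ false × X (suc k * 3) ≡ false
    ends∉P = perfectPath-tight (suc k) X (inP-perfectPath (suc k) P perfect e) tight
    2≤m : 2 ≤ 3 * suc k
    2≤m = subst (2 ≤_) (*-comm (suc k) 3) (s≤s (s≤s z≤n))

lemma7 : (G : FinGraph) → IsSimpleGraph G → (r : ℕ) → Regular G r →
         (k : ℕ) → (e : E G) →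
         (P : E (Subdivision G (3 * k)) → Bool) →
         PerfectEDS (Subdivision G (3 * k)) P →
         (k ≤ pathCount G (3 * k) e P)
         × (pathCount G (3 * k) e P ≡ k →
              (P (e , zero) ≡ false)
            × (P (e , fromℕ (3 * k)) ≡ false)
            × ExactlyOne (White (Subdivision G (3 * k)) P) (inj₁ (proj₁ (ends G e))) (inj₁ (proj₂ (ends G e)))
            × ExactlyOne (Yellow (Subdivision G (3 * k)) P) (inj₁ (proj₁ (ends G e))) (inj₁ (proj₂ (ends G e))))
lemma7 G simpleG _ _ k e P perfect =
  subst (k ≤_) (sym pathCount≡) (perfectPath-count k X perfectX) ,
  λ count≡k →
    let tight = trans (sym pathCount≡) count≡k
        e₀∉P , eₘ∉P = perfectPath-tight k X perfectX tight
    in e₀∉P , trans (sym (inP-last G simpleG k P perfect e)) eₘ∉P ,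
       exactlyOne-white-yellow (Subdivision G (3 * k)) P v w (pdeg-ends-tight G simpleG k P perfect e tight)
  where
  X : ℕ → Bool
  X = inP G simpleG k P perfect e
  perfectX : PerfectPath X (k * 3)
  perfectX = inP-perfectPath G simpleG k P perfect e
  pathCount≡ : pathCount G (3 * k) e P ≡ countUpTo X (suc (k * 3))
  pathCount≡ = pathCount≡countUpTo G simpleG k P perfect e
  v w : V (Subdivision G (3 * k))
  v = inj₁ (proj₁ (ends G e))
  w = inj₁ (proj₂ (ends G e))
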